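{- Let $p$ be a prime and let $x,y,z\in\mathbb{F}_p^N$ satisfy $\sum_{j=1}^N x(j)^i\,y(j)^a\,z(j)^b=0$ for all $0\le a,b,i\le p-1$. Then $$(S_{2p})_{y,z}(x)=\mathcal{H}\big(y^{(p)},z^{(p)}\big).$$
   Context: Convention $0^0=1$. $S_{2p}(x)=\sum_{S\subseteq[N],|S|=2p}\prod_{i\in S}x_i$; for $f:\mathbb{F}_p^N\to\mathbb{F}_p$, $f_y(x)=f(x+y)-f(x)$ and $f_{y,z}=(f_y)_z$. $\mathcal{H}(y^{(p)},z^{(p)})=\sum_\rho\prod_{i=1}^{p}y(\rho(i))\prod_{i=p+1}^{2p}z(\rho(i))$, where $\rho$ ranges over injective maps $[2p]\to[N]$ with $\rho(1)<\dots<\rho(p)$ and $\rho(p+1)<\dots<\rho(2p)$. -}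

module Defs where

open import Data.Nat as ℕ using (ℕ; zero; suc; _≟_)
open import Data.Integer using (ℤ; 0ℤ; 1ℤ; _+_; _*_; _-_)
open import Data.Fin using (Fin; zero; suc)
open import Data.Fin.Subset using (Subset; inside; outside; ∣_∣; _∩_)
open import Data.Vec using (Vec; []; _∷_)
open import Data.List using (List; []; _∷_; _++_; map; filter; foldr; cartesianProduct)
open import Data.List using () renaming ([_] to [_]ₗ)
open import Data.Product using (_×_; _,_; proj₁; proj₂)
open import Relation.Nullary.Decidable using (_×-dec_)

-- Vectors in F_p^N are represented by integer representatives  Fin N → ℤ;
-- equality in F_p is congruence mod p (see Statement).
Vect : ℕ → Set
Vect N = Fin N → ℤ

sumℤ : List ℤ → ℤ
sumℤ = foldr _+_ 0ℤ

Σ[j] : (N : ℕ) → (Fin N → ℤ) → ℤ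
Σ[j] zero    f = 0ℤ
Σ[j] (suc N) f = f zero + Σ[j] N (λ j → f (suc j))

subsets : (N : ℕ) → List (Subset N)
subsets zero    = [ [] ]ₗ
subsets (suc N) = map (outside ∷_) (subsets N) ++ map (inside ∷_) (subsets N)

prodOver : {N : ℕ} → Subset N → Vect N → ℤ
prodOver []            x = 1ℤ
prodOver (outside ∷ S) x = prodOver S (λ j → x (suc j))
prodOver (inside  ∷ S) x = x zero * prodOver S (λ j → x (suc j))

elemSym : {N : ℕ} → ℕ → Vect N → ℤ
elemSym {N} k x =
  sumℤ (map (λ S → prodOver S x) (filter (λ S → ∣ S ∣ ≟ k) (subsets N)))

_⊕_ : {N : ℕ} → Vect N → Vect N → Vect N
(x ⊕ y) j = x j + y j

Δ : {N : ℕ} → Vect N → (Vect N → ℤ) → (Vect N → ℤ)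
Δ y f x = f (x ⊕ y) - f x

Δ² : {N : ℕ} → Vect N → Vect N → (Vect N → ℤ) → (Vect N → ℤ)
Δ² y z f = Δ z (Δ y f)

-- H(y^(p), z^(p)) = Σ_ρ ∏_{i≤p} y(ρ i) ∏_{p<i≤2p} z(ρ i), ρ injective [2p]→[N],
-- increasing on each half.  Such ρ correspond bijectively to pairs (A , B)
-- of disjoint subsets of [N] with |A| = |B| = p (A = ρ[1..p], B = ρ[p+1..2p]).
H : {N : ℕ} → ℕ → Vect N → Vect N → ℤ
H {N} p y z =
  sumℤ (map (λ AB → prodOver (proj₁ AB) y * prodOver (proj₂ AB) z)
            (filter (λ AB → (∣ proj₁ AB ∣ ≟ p)
                            ×-dec ((∣ proj₂ AB ∣ ≟ p)
                            ×-dec (∣ proj₁ AB ∩ proj₂ AB ∣ ≟ 0)))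
                    (cartesianProduct (subsets N) (subsets N))))

module Submission where

-- Let G(k,b,c) be the coefficient of t^k u^b v^c in  P = ∏_j (1 + t(x_j + u y_j + v z_j)),
-- indexed by ℤ³ so that multiplication by t, u, v is a shift without boundary cases, and let
-- T_φ = Σ_j φ_j · (coefficients of P with the j-th factor removed).
-- For k = 2p every term but (b,c) = (p,p) vanishes mod p: if p ∤ b or p ∤ c by the derivative
-- identities and Euclid's lemma, otherwise because b + c > 2p.  The remaining term is H.

open import Defs
open import Data.Nat as ℕ using (ℕ; zero; suc; z≤n; s≤s)
import Data.Nat.Properties as ℕ
import Data.Nat.Divisibility as ℕ
open import Data.Nat.Combinatorics
  using (nCn≡1; nC1≡n; nCk+nC[k+1]≡[n+1]C[k+1]) renaming (_C_ to _choose_)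
open import Data.Nat.Combinatorics.Specification using (k>n⇒nCk≡0)
open import Data.Nat.Primality using (Prime; euclidsLemma; ¬prime[0]; ¬prime[1])
open import Data.Nat.Induction using (<-rec)
import Data.Nat.Tactic.RingSolver as ℕ-Solver
open import Data.Integer as ℤ using (ℤ; +_; -[1+_]; _+_; _*_; _-_; -_; 0ℤ; 1ℤ; -1ℤ; _^_)
open import Data.Integer.Properties
  using ( +-*-semiring; +-*-commutativeSemiring; +-identityˡ; +-identityʳ; +-assoc; +-inverseʳ
        ; *-identityˡ; *-identityʳ; *-zeroʳ; *-assoc; *-distribˡ-+; *-distribʳ-+; ^-zeroˡ; ^-distribˡ-+-*
        ; abs-*; +-monoʳ-<; +-monoˡ-<; <-trans; <-≤-trans; ≤-trans; <⇒≤ )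
open import Data.Integer.Divisibility.Signed
  using (_∣_; divides; ∣ᵤ⇒∣; ∣⇒∣ᵤ; ∣m+n∣n⇒∣m; ∣m∣n⇒∣m+n; ∣m∣n⇒∣m-n; ∣m⇒∣-m; ∣m⇒∣m*n)
import Data.Integer.Divisibility as Unsigned
open import Data.Integer.Tactic.RingSolver using (solve-∀)
open import Data.Fin as Fin using (Fin; toℕ; inject₁; fromℕ; punchIn)
open import Data.Fin.Properties
  using (toℕ-inject₁; toℕ-fromℕ; toℕ-fromℕ<; toℕ-injective; toℕ<n; punchInᵢ≢i)
open import Data.Fin.Subset using (Subset; inside; outside; ∣_∣; _∩_)
open import Data.Vec as Vec using (_∷_)
open import Data.Vec.Functional using (head; tail)
open import Data.List as List using (List; []; _∷_)
import Data.List.Properties as List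
open import Data.Bool using (true; false; if_then_else_; _∧_)
open import Data.Bool.Properties using (∧-zeroʳ)
open import Data.Product using (∃-syntax; _×_; _,_)
open import Data.Sum as Sum using (_⊎_; inj₁; inj₂)
open import Function using (_∘_)
open import Relation.Unary using (Decidable)
open import Relation.Binary.PropositionalEquality
open import Relation.Nullary using (¬_; yes; no; does; contradiction)

open import Algebra.Properties.Semiring.Sum +-*-semiring
  using (sum; sum-cong-≗; sum-init-last; sum-remove; sum-replicate-zero; ∑-distrib-+; *-distribˡ-sum)
open import Algebra.Properties.Semiring.Mult +-*-semiring using () renaming (_×_ to _×ₛ_)
open import Algebra.Properties.Semiring.Exp +-*-semiring using () renaming (_^_ to _^ₛ_)
import Algebra.Properties.CommutativeSemiring.Binomial +-*-commutativeSemiring as Binomial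

open ≡-Reasoning

cong₄ : ∀ {A B C D E : Set} (f : A → B → C → D → E) {a a′ b b′ c c′ d d′} →
        a ≡ a′ → b ≡ b′ → c ≡ c′ → d ≡ d′ → f a b c d ≡ f a′ b′ c′ d′
cong₄ f refl refl refl refl = refl

∣-refl-diff : ∀ {m} a → m ∣ a - a
∣-refl-diff a = subst (_ ∣_) (sym (+-inverseʳ a)) (divides 0ℤ refl)

∣-trans-diff : ∀ {m a b c} → m ∣ a - b → m ∣ b - c → m ∣ a - c
∣-trans-diff {a = a} {b} {c} m∣a-b m∣b-c = subst (_ ∣_) (telescope a b c) (∣m∣n⇒∣m+n m∣a-b m∣b-c)
  where telescope : ∀ a b c → (a - b) + (b - c) ≡ a - c
        telescope = solve-∀

∣-from-diff : ∀ {m a b} → m ∣ a - b → m ∣ b → m ∣ a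
∣-from-diff {a = a} {b} m∣a-b m∣b = subst (_ ∣_) (cancel a b) (∣m∣n⇒∣m+n m∣a-b m∣b)
  where cancel : ∀ a b → a - b + b ≡ a
        cancel = solve-∀

∣-*-diff : ∀ {m a a′ b b′} → m ∣ a - a′ → m ∣ b - b′ → m ∣ a * b - a′ * b′
∣-*-diff {a = a} {a′} {b} {b′} m∣a m∣b =
  subst (_ ∣_) (regroup a a′ b b′) (∣m∣n⇒∣m+n (∣m⇒∣m*n b m∣a) (∣m⇒∣m*n a′ m∣b))
  where regroup : ∀ a a′ b b′ → (a - a′) * b + (b - b′) * a′ ≡ a * b - a′ * b′
        regroup = solve-∀

Σ[j]≡sum : ∀ N f → Σ[j] N f ≡ sum f
Σ[j]≡sum zero    f = refl
Σ[j]≡sum (suc N) f = cong (λ t → f Fin.zero + t) (Σ[j]≡sum N (f ∘ Fin.suc))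

∣-sum : ∀ {m n} {f : Fin n → ℤ} → (∀ i → m ∣ f i) → m ∣ sum f
∣-sum {n = zero}  _     = divides 0ℤ refl
∣-sum {n = suc n} m∣f = ∣m∣n⇒∣m+n (m∣f Fin.zero) (∣-sum (m∣f ∘ Fin.suc))

sum-sub : ∀ {n} (f g : Fin n → ℤ) → sum f - sum g ≡ sum (λ i → f i - g i)
sum-sub {zero}  f g = refl
sum-sub {suc n} f g = begin
  (f₀ + sum (f ∘ Fin.suc)) - (g₀ + sum (g ∘ Fin.suc))
    ≡⟨ interchange f₀ g₀ _ _ ⟩
  (f₀ - g₀) + (sum (f ∘ Fin.suc) - sum (g ∘ Fin.suc))
    ≡⟨ cong (λ t → (f₀ - g₀) + t) (sum-sub (f ∘ Fin.suc) (g ∘ Fin.suc)) ⟩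
  (f₀ - g₀) + sum (λ i → f (Fin.suc i) - g (Fin.suc i)) ∎
  where
  f₀ = f Fin.zero
  g₀ = g Fin.zero
  interchange : ∀ a b c d → (a + c) - (b + d) ≡ (a - b) + (c - d)
  interchange = solve-∀

∣-sum-diff : ∀ {m n} {f g : Fin n → ℤ} → (∀ i → m ∣ f i - g i) → m ∣ sum f - sum g
∣-sum-diff {f = f} {g} m∣f-g = subst (_ ∣_) (sym (sum-sub f g)) (∣-sum m∣f-g)

∣-sum-isolate : ∀ {m n} {f : Fin n → ℤ} (i₀ : Fin n) → (∀ i → i ≢ i₀ → m ∣ f i) → m ∣ sum f - f i₀
∣-sum-isolate {m} {suc n} {f} i₀ m∣others =
  subst (m ∣_) (sym rest) (∣-sum (λ j → m∣others _ (punchInᵢ≢i i₀ j)))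
  where
  rest : sum f - f i₀ ≡ sum (λ j → f (punchIn i₀ j))
  rest = begin
    sum f - f i₀                                     ≡⟨ cong (_- f i₀) (sum-remove {i = i₀} f) ⟩
    (f i₀ + sum (λ j → f (punchIn i₀ j))) - f i₀     ≡⟨ cancel (f i₀) _ ⟩
    sum (λ j → f (punchIn i₀ j))                     ∎
    where cancel : ∀ a s → (a + s) - a ≡ s
          cancel = solve-∀

∣-sum²-isolate : ∀ {m n} {f : Fin n → Fin n → ℤ} (i₀ j₀ : Fin n) →
  (∀ i j → i ≢ i₀ ⊎ j ≢ j₀ → m ∣ f i j) → m ∣ sum (λ i → sum (f i)) - f i₀ j₀
∣-sum²-isolate {f = f} i₀ j₀ off =
  ∣-trans-diff {a = sum (λ i → sum (f i))} {b = sum (f i₀)}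
    (∣-sum-isolate i₀ λ i i≢i₀ → ∣-sum (λ j → off i j (inj₁ i≢i₀)))
    (∣-sum-isolate j₀ λ j j≢j₀ → off i₀ j (inj₂ j≢j₀))

-- The semiring-generic ℕ-multiple and power used by the library's binomial theorem agree
-- with those of ℤ.
×ₛ≡* : ∀ n a → n ×ₛ a ≡ + n * a
×ₛ≡* zero    a = refl
×ₛ≡* (suc n) a = begin
  a + n ×ₛ a        ≡⟨ cong (λ t → a + t) (×ₛ≡* n a) ⟩
  a + + n * a       ≡⟨ cong (_+ + n * a) (sym (*-identityˡ a)) ⟩
  1ℤ * a + + n * a  ≡⟨ sym (*-distribʳ-+ a 1ℤ (+ n)) ⟩
  + suc n * a       ∎

^ₛ≡^ : ∀ a n → a ^ₛ n ≡ a ^ n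
^ₛ≡^ a zero    = refl
^ₛ≡^ a (suc n) = cong (a *_) (^ₛ≡^ a n)

absorption : ∀ n k → suc k ℕ.* (suc n choose suc k) ≡ suc n ℕ.* (n choose k)
absorption zero    zero    = refl
absorption zero    (suc k) = begin
  suc (suc k) ℕ.* (1 choose suc (suc k))
    ≡⟨ cong (suc (suc k) ℕ.*_) (k>n⇒nCk≡0 {1} {suc (suc k)} (s≤s (s≤s z≤n))) ⟩
  suc (suc k) ℕ.* 0
    ≡⟨ ℕ.*-zeroʳ (suc (suc k)) ⟩
  0
    ≡⟨ cong (1 ℕ.*_) (k>n⇒nCk≡0 {0} {suc k} (s≤s z≤n)) ⟨
  1 ℕ.* (0 choose suc k) ∎
absorption (suc n) zero    = begin
  1 ℕ.* (suc (suc n) choose 1)  ≡⟨ ℕ.*-identityˡ _ ⟩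
  suc (suc n) choose 1          ≡⟨ nC1≡n (suc (suc n)) ⟩
  suc (suc n)                   ≡⟨ ℕ.*-identityʳ (suc (suc n)) ⟨
  suc (suc n) ℕ.* 1             ∎
absorption (suc n) (suc k) = begin
  (2 ℕ.+ k) ℕ.* (suc (suc n) choose suc (suc k))
    ≡⟨ cong ((2 ℕ.+ k) ℕ.*_) (nCk+nC[k+1]≡[n+1]C[k+1] (suc n) (suc k)) ⟨
  (2 ℕ.+ k) ℕ.* (a ℕ.+ b)
    ≡⟨ regroup k a b ⟩
  (1 ℕ.+ k) ℕ.* a ℕ.+ a ℕ.+ (2 ℕ.+ k) ℕ.* b
    ≡⟨ cong₂ (λ s t → s ℕ.+ a ℕ.+ t) (absorption n k) (absorption n (suc k)) ⟩
  suc n ℕ.* (n choose k) ℕ.+ a ℕ.+ suc n ℕ.* (n choose suc k)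
    ≡⟨ regroup′ n a (n choose k) (n choose suc k) ⟩
  suc n ℕ.* (n choose k ℕ.+ n choose suc k) ℕ.+ a
    ≡⟨ cong (λ s → suc n ℕ.* s ℕ.+ a) (nCk+nC[k+1]≡[n+1]C[k+1] n k) ⟩
  suc n ℕ.* a ℕ.+ a
    ≡⟨ ℕ.+-comm (suc n ℕ.* a) a ⟩
  suc (suc n) ℕ.* a ∎
  where
  a = suc n choose suc k
  b = suc n choose suc (suc k)
  regroup : ∀ k a b → (2 ℕ.+ k) ℕ.* (a ℕ.+ b) ≡ (1 ℕ.+ k) ℕ.* a ℕ.+ a ℕ.+ (2 ℕ.+ k) ℕ.* b
  regroup = ℕ-Solver.solve-∀
  regroup′ : ∀ n a c d → suc n ℕ.* c ℕ.+ a ℕ.+ suc n ℕ.* d ≡ suc n ℕ.* (c ℕ.+ d) ℕ.+ a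
  regroup′ = ℕ-Solver.solve-∀

prime∣binomial : ∀ {p k} → Prime p → 0 ℕ.< k → k ℕ.< p → p ℕ.∣ p choose k
prime∣binomial {suc n} {suc j} pr _ k<p with euclidsLemma (suc j) (suc n choose suc j) pr p∣k·C
  where
  p∣k·C : suc n ℕ.∣ suc j ℕ.* (suc n choose suc j)
  p∣k·C = ℕ.divides (n choose j) (trans (absorption n j) (ℕ.*-comm (suc n) (n choose j)))
... | inj₁ p∣k = contradiction (ℕ.∣⇒≤ p∣k) (ℕ.<⇒≱ k<p)
... | inj₂ p∣C = p∣C

-- The freshman's dream  (a + b)^p ≡ a^p + b^p (mod p): the inner terms of the binomial
-- expansion are multiples of p.
freshman : ∀ {p} → Prime p → ∀ a b → + p ∣ (a + b) ^ p - (a ^ p + b ^ p)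
freshman {zero} pr = contradiction pr ¬prime[0]
freshman {suc p′} pr a b = subst (+ p ∣_) (sym expansion) (∣-sum inner∣)
  where
  p = suc p′
  term : Fin (suc p) → ℤ
  term = Binomial.binomialTerm a b p

  inner∣ : ∀ i → + p ∣ term (Fin.suc (inject₁ i))
  inner∣ i = subst (+ p ∣_) (sym (×ₛ≡* (p choose k) _))
                   (∣m⇒∣m*n {m = + (p choose k)} (Binomial.binomial a b p (Fin.suc (inject₁ i))) (∣ᵤ⇒∣ p∣C))
    where
    k = suc (toℕ (inject₁ i))
    p∣C : p ℕ.∣ p choose k
    p∣C = prime∣binomial pr (s≤s z≤n) (s≤s (subst (ℕ._< p′) (sym (toℕ-inject₁ i)) (toℕ<n i)))

  middle : ℤ
  middle = sum (λ i → term (Fin.suc (inject₁ i)))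

  first : term Fin.zero ≡ b ^ p
  first = begin
    1 ×ₛ (1ℤ * b ^ₛ p) ≡⟨ ×ₛ≡* 1 _ ⟩
    1ℤ * (1ℤ * b ^ₛ p) ≡⟨ cong (λ t → 1ℤ * (1ℤ * t)) (^ₛ≡^ b p) ⟩
    1ℤ * (1ℤ * b ^ p)  ≡⟨ unit-left (b ^ p) ⟩
    b ^ p              ∎
    where unit-left : ∀ x → 1ℤ * (1ℤ * x) ≡ x
          unit-left = solve-∀

  final : term (Fin.suc (fromℕ p′)) ≡ a ^ p
  final = begin
    term (Fin.suc (fromℕ p′))
      ≡⟨ cong (λ k → (p choose k) ×ₛ (a ^ₛ k * b ^ₛ (p ℕ.∸ k))) (cong suc (toℕ-fromℕ p′)) ⟩
    (p choose p) ×ₛ (a ^ₛ p * b ^ₛ (p ℕ.∸ p))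
      ≡⟨ cong₂ (λ c e → c ×ₛ (a ^ₛ p * b ^ₛ e)) (nCn≡1 p) (ℕ.n∸n≡0 p) ⟩
    1 ×ₛ (a ^ₛ p * 1ℤ)
      ≡⟨ ×ₛ≡* 1 _ ⟩
    1ℤ * (a ^ₛ p * 1ℤ)
      ≡⟨ cong (λ t → 1ℤ * (t * 1ℤ)) (^ₛ≡^ a p) ⟩
    1ℤ * (a ^ p * 1ℤ)
      ≡⟨ unit-both (a ^ p) ⟩
    a ^ p ∎
    where unit-both : ∀ x → 1ℤ * (x * 1ℤ) ≡ x
          unit-both = solve-∀

  expansion : (a + b) ^ p - (a ^ p + b ^ p) ≡ middle
  expansion = begin
    (a + b) ^ p - (a ^ p + b ^ p)
      ≡⟨ cong (_- (a ^ p + b ^ p)) (trans (sym (^ₛ≡^ (a + b) p)) (Binomial.theorem p a b)) ⟩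
    (term Fin.zero + sum (term ∘ Fin.suc)) - (a ^ p + b ^ p)
      ≡⟨ cong (λ t → (term Fin.zero + t) - (a ^ p + b ^ p)) (sum-init-last (term ∘ Fin.suc)) ⟩
    (term Fin.zero + (middle + term (Fin.suc (fromℕ p′)))) - (a ^ p + b ^ p)
      ≡⟨ cong₂ (λ s t → (s + (middle + t)) - (a ^ p + b ^ p)) first final ⟩
    (b ^ p + (middle + a ^ p)) - (a ^ p + b ^ p)
      ≡⟨ cancel (a ^ p) (b ^ p) middle ⟩
    middle ∎
    where cancel : ∀ A B M → (B + (M + A)) - (A + B) ≡ M
          cancel = solve-∀

-- Fermat's little theorem  a^p ≡ a (mod p), by induction on a ∈ ℕ and the freshman's dream
-- with b = -a for negative a.
fermat : ∀ {p} → Prime p → ∀ a → + p ∣ a ^ p - a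
fermat {zero} pr = contradiction pr ¬prime[0]
fermat {suc p′} pr (+ n) = fermat-ℕ n
  where
  p = suc p′
  fermat-ℕ : ∀ n → + p ∣ (+ n) ^ p - + n
  fermat-ℕ zero    = divides 0ℤ refl
  fermat-ℕ (suc n) = subst (+ p ∣_) (regroup ((+ suc n) ^ p) ((+ n) ^ p) (+ n))
    (∣m∣n⇒∣m+n (subst (λ o → + p ∣ (+ suc n) ^ p - (o + (+ n) ^ p)) (^-zeroˡ p) (freshman pr 1ℤ (+ n)))
               (fermat-ℕ n))
    where regroup : ∀ S N n → (S - (1ℤ + N)) + (N - n) ≡ S - (1ℤ + n)
          regroup = solve-∀
fermat {suc p′} pr -[1+ n ] = subst (+ p ∣_) (regroup (v ^ p) ((- v) ^ p) v)
    (∣m∣n⇒∣m-n (∣m⇒∣-m (subst (λ z → + p ∣ z ^ p - (v ^ p + (- v) ^ p)) (+-inverseʳ v) dream))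
               (fermat pr v))
  where
  p = suc p′
  v = + suc n
  dream : + p ∣ (v + - v) ^ p - (v ^ p + (- v) ^ p)
  dream = freshman pr v (- v)
  regroup : ∀ V W v → - (0ℤ - (V + W)) - (V - v) ≡ W - - v
  regroup = solve-∀

power-shift : ∀ {p} → Prime p → ∀ a e → + p ∣ a ^ (p ℕ.+ e) - a ^ suc e
power-shift {p} pr a e = subst (+ p ∣_) (sym factored) (∣m⇒∣m*n (a ^ e) (fermat pr a))
  where
  factored : a ^ (p ℕ.+ e) - a ^ suc e ≡ (a ^ p - a) * a ^ e
  factored = begin
    a ^ (p ℕ.+ e) - a * a ^ e  ≡⟨ cong (_- a * a ^ e) (^-distribˡ-+-* a p e) ⟩
    a ^ p * a ^ e - a * a ^ e  ≡⟨ factor-out (a ^ p) a (a ^ e) ⟩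
    (a ^ p - a) * a ^ e        ∎
    where factor-out : ∀ P a E → P * E - a * E ≡ (P - a) * E
          factor-out = solve-∀

power-reduction : ∀ {p} → Prime p → ∀ i → ∃[ r ] (r ℕ.< p × ∀ a → + p ∣ a ^ i - a ^ r)
power-reduction {zero} pr = contradiction pr ¬prime[0]
power-reduction {suc zero} pr = contradiction pr ¬prime[1]
power-reduction {p@(suc (suc q))} pr = <-rec _ reduce
  where
  Reducible : ℕ → Set
  Reducible i = ∃[ r ] (r ℕ.< p × ∀ a → + p ∣ a ^ i - a ^ r)

  shifted : ∀ e → (∀ {j} → j ℕ.< p ℕ.+ e → Reducible j) → Reducible (p ℕ.+ e)
  shifted e rec with rec {suc e} (s≤s (s≤s (ℕ.m≤n+m e q)))
  ... | r , r<p , reduced =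
    r , r<p , λ a → ∣-trans-diff {a = a ^ (p ℕ.+ e)} {b = a ^ suc e} (power-shift pr a e) (reduced a)

  reduce : ∀ i → (∀ {j} → j ℕ.< i → Reducible j) → Reducible i
  reduce i rec with i ℕ.<? p
  ... | yes i<p = i , i<p , ∣-refl-diff ∘ (_^ i)
  ... | no  i≮p =
    subst Reducible p+e≡i (shifted (i ℕ.∸ p) (λ {j} j<p+e → rec (subst (j ℕ.<_) p+e≡i j<p+e)))
    where p+e≡i = ℕ.m+[n∸m]≡n (ℕ.≮⇒≥ i≮p)

prime-cancel : ∀ {p n g} → Prime p → ¬ p ℕ.∣ n → + p ∣ + n * g → + p ∣ g
prime-cancel {p} {n} {g} pr p∤n p∣ng
  with euclidsLemma n ℤ.∣ g ∣ pr (subst (p ℕ.∣_) (abs-* (+ n) g) (∣⇒∣ᵤ p∣ng))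
... | inj₁ p∣n = contradiction p∣n p∤n
... | inj₂ p∣g = ∣ᵤ⇒∣ p∣g

multiple≥2p : ∀ {p n} → p ℕ.∣ n → 0 ℕ.< n → n ≢ p → 2 ℕ.* p ℕ.≤ n
multiple≥2p (ℕ.divides zero          refl) ()
multiple≥2p {p} (ℕ.divides (suc zero) refl) _ n≢p = contradiction (ℕ.+-identityʳ p) n≢p
multiple≥2p {p} (ℕ.divides (suc (suc q)) refl) _ _ = ℕ.+-monoʳ-≤ p (ℕ.+-monoʳ-≤ p z≤n)

monomial : ∀ {N} → Vect N → Vect N → Vect N → ℕ → ℕ → ℕ → Fin N → ℤ
monomial x y z i a b j = x j ^ i * y j ^ a * z j ^ b

all-moments : ∀ {p N} → Prime p → (x y z : Vect N) →
  (∀ i a b → i ℕ.< p → a ℕ.< p → b ℕ.< p → + p ∣ sum (monomial x y z i a b)) →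
  ∀ i a b → + p ∣ sum (monomial x y z i a b)
all-moments {p} pr x y z small i a b
  with power-reduction pr i | power-reduction pr a | power-reduction pr b
... | i′ , i′<p , xⁱ≡xⁱ′ | a′ , a′<p , yᵃ≡yᵃ′ | b′ , b′<p , zᵇ≡zᵇ′ =
  ∣-from-diff (∣-sum-diff termwise) (small i′ a′ b′ i′<p a′<p b′<p)
  where
  termwise : ∀ j → + p ∣ monomial x y z i a b j - monomial x y z i′ a′ b′ j
  termwise j = ∣-*-diff {a = x j ^ i * y j ^ a} {b = z j ^ b}
                 (∣-*-diff {a = x j ^ i} {b = y j ^ a} (xⁱ≡xⁱ′ (x j)) (yᵃ≡yᵃ′ (y j))) (zᵇ≡zᵇ′ (z j))

-- Coefficient arrays of polynomials in t, u, v:  X k b c  is the coefficient of t^k u^b v^c.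
-- Indices range over ℤ (coefficients at negative indices are 0 for all arrays built below), so
-- multiplication by t, u, v is a plain index shift.
Coeffs : Set
Coeffs = ℤ → ℤ → ℤ → ℤ

infix 4 _≐_
infixr 7 _⊙_

_≐_ : Coeffs → Coeffs → Set
X ≐ Y = ∀ k b c → X k b c ≡ Y k b c

δ : ℤ → ℤ
δ (+ zero) = 1ℤ
δ _        = 0ℤ

one : Coeffs
one k b c = δ k * δ b * δ c

_⊙_ : ℤ → Coeffs → Coeffs
(s ⊙ X) k b c = s * X k b c

-- combine A B C D  is  A + t·(B + u·C + v·D).
combine : Coeffs → Coeffs → Coeffs → Coeffs → Coeffs
combine A B C D k b c = A k b c + B (k - 1ℤ) b c + C (k - 1ℤ) (b - 1ℤ) c + D (k - 1ℤ) b (c - 1ℤ)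

factor : ℤ → ℤ → ℤ → Coeffs → Coeffs
factor α β γ X = combine X (α ⊙ X) (β ⊙ X) (γ ⊙ X)

factor-cong : ∀ α β γ {X Y} → X ≐ Y → factor α β γ X ≐ factor α β γ Y
factor-cong α β γ X≐Y k b c =
  cong₂ _+_ (cong₂ _+_ (cong₂ _+_ (X≐Y k b c) (cong (α *_) (X≐Y (k - 1ℤ) b c)))
                       (cong (β *_) (X≐Y (k - 1ℤ) (b - 1ℤ) c)))
            (cong (γ *_) (X≐Y (k - 1ℤ) b (c - 1ℤ)))

factor-scale : ∀ α β γ s X → factor α β γ (s ⊙ X) ≐ s ⊙ factor α β γ X
factor-scale α β γ s X k b c =
  pull-out α β γ s (X k b c) (X (k - 1ℤ) b c) (X (k - 1ℤ) (b - 1ℤ) c) (X (k - 1ℤ) b (c - 1ℤ))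
  where pull-out : ∀ α β γ s a₁ a₂ a₃ a₄ →
                   s * a₁ + α * (s * a₂) + β * (s * a₃) + γ * (s * a₄)
                   ≡ s * (a₁ + α * a₂ + β * a₃ + γ * a₄)
        pull-out = solve-∀

-- Multiplication by the factor commutes with combine: both are multiplications by polynomials.
factor-combine : ∀ α β γ A B C D →
  factor α β γ (combine A B C D)
  ≐ combine (factor α β γ A) (factor α β γ B) (factor α β γ C) (factor α β γ D)
factor-combine α β γ A B C D k b c = commute α β γ
  (A k b c)   (A k′ b c)   (A k′ b′ c)   (A k′ b c′)
  (B k′ b c)  (B k″ b c)   (B k″ b′ c)   (B k″ b c′)
  (C k′ b′ c) (C k″ b′ c)  (C k″ b″ c)  (C k″ b′ c′)
  (D k′ b c′) (D k″ b c′)  (D k″ b′ c′) (D k″ b c″)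
  where
  k′ = k - 1ℤ
  k″ = k′ - 1ℤ
  b′ = b - 1ℤ
  b″ = b′ - 1ℤ
  c′ = c - 1ℤ
  c″ = c′ - 1ℤ
  commute : ∀ α β γ a₁ a₂ a₃ a₄ b₁ b₂ b₃ b₄ c₁ c₂ c₃ c₄ d₁ d₂ d₃ d₄ →
    (a₁ + b₁ + c₁ + d₁) + α * (a₂ + b₂ + c₂ + d₂)
      + β * (a₃ + b₃ + c₃ + d₃) + γ * (a₄ + b₄ + c₄ + d₄)
    ≡ (a₁ + α * a₂ + β * a₃ + γ * a₄) + (b₁ + α * b₂ + β * b₃ + γ * b₄)
      + (c₁ + α * c₂ + β * c₃ + γ * c₄) + (d₁ + α * d₂ + β * d₃ + γ * d₄)
  commute = solve-∀

middle-zero : ∀ a c → a * 0ℤ * c ≡ 0ℤ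
middle-zero = solve-∀

factor-zero : ∀ α β γ {X k b c} →
  X k b c ≡ 0ℤ → X (k - 1ℤ) b c ≡ 0ℤ →
  X (k - 1ℤ) (b - 1ℤ) c ≡ 0ℤ → X (k - 1ℤ) b (c - 1ℤ) ≡ 0ℤ →
  factor α β γ X k b c ≡ 0ℤ
factor-zero α β γ e₁ e₂ e₃ e₄ rewrite e₁ | e₂ | e₃ | e₄ = zeros α β γ
  where zeros : ∀ α β γ → 0ℤ + α * 0ℤ + β * 0ℤ + γ * 0ℤ ≡ 0ℤ
        zeros = solve-∀

_·_ : ∀ {N} → Vect N → Vect N → Vect N
(φ · x) j = φ j * x j

-- prodCoeffs N x y z: coefficients of  P = ∏_j (1 + t(x_j + u y_j + v z_j)).
prodCoeffs : (N : ℕ) → Vect N → Vect N → Vect N → Coeffs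
prodCoeffs zero    x y z = one
prodCoeffs (suc N) x y z = factor (head x) (head y) (head z) (prodCoeffs N (tail x) (tail y) (tail z))

-- markedCoeffs N φ x y z: coefficients of  Σ_j φ_j ∏_{i ≠ j} (1 + t(x_i + u y_i + v z_i)).
markedCoeffs : (N : ℕ) → Vect N → Vect N → Vect N → Vect N → Coeffs
markedCoeffs zero    φ x y z k b c = 0ℤ
markedCoeffs (suc N) φ x y z k b c =
  head φ * prodCoeffs N (tail x) (tail y) (tail z) k b c
  + factor (head x) (head y) (head z) (markedCoeffs N (tail φ) (tail x) (tail y) (tail z)) k b c

-- Since each term of markedCoeffs times its missing factor is P:
-- T_φ + t(T_{φx} + u T_{φy} + v T_{φz}) = (Σ_j φ_j) P.
marked-identity : ∀ N φ x y z →
  combine (markedCoeffs N φ x y z) (markedCoeffs N (φ · x) x y z)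
          (markedCoeffs N (φ · y) x y z) (markedCoeffs N (φ · z) x y z)
  ≐ sum φ ⊙ prodCoeffs N x y z
marked-identity zero    φ x y z k b c = refl
marked-identity (suc N) φ x y z k b c = begin
  combine (T φ) (T (φ · x)) (T (φ · y)) (T (φ · z)) k b c
    ≡⟨ separate φ₀ x₀ y₀ z₀ (G′ k b c) (G′ k′ b c) (G′ k′ b′ c) (G′ k′ b c′)
                (F T₁ k b c) (F T₂ k′ b c) (F T₃ k′ b′ c) (F T₄ k′ b c′) ⟩
  φ₀ * F G′ k b c + combine (F T₁) (F T₂) (F T₃) (F T₄) k b c
    ≡⟨ cong (λ t → φ₀ * F G′ k b c + t) (sym (factor-combine x₀ y₀ z₀ T₁ T₂ T₃ T₄ k b c)) ⟩
  φ₀ * F G′ k b c + F (combine T₁ T₂ T₃ T₄) k b c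
    ≡⟨ cong (λ t → φ₀ * F G′ k b c + t)
            (factor-cong x₀ y₀ z₀ (marked-identity N φ′ x′ y′ z′) k b c) ⟩
  φ₀ * F G′ k b c + F (sum φ′ ⊙ G′) k b c
    ≡⟨ cong (λ t → φ₀ * F G′ k b c + t) (factor-scale x₀ y₀ z₀ (sum φ′) G′ k b c) ⟩
  φ₀ * F G′ k b c + sum φ′ * F G′ k b c
    ≡⟨ *-distribʳ-+ (F G′ k b c) φ₀ (sum φ′) ⟨
  (φ₀ + sum φ′) * F G′ k b c ∎
  where
  φ₀ = head φ
  x₀ = head x
  y₀ = head y
  z₀ = head z
  φ′ = tail φ
  x′ = tail x
  y′ = tail y
  z′ = tail z
  T  = λ ψ → markedCoeffs (suc N) ψ x y z
  F  = factor x₀ y₀ z₀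
  G′ = prodCoeffs N x′ y′ z′
  T₁ = markedCoeffs N φ′ x′ y′ z′
  T₂ = markedCoeffs N (φ′ · x′) x′ y′ z′
  T₃ = markedCoeffs N (φ′ · y′) x′ y′ z′
  T₄ = markedCoeffs N (φ′ · z′) x′ y′ z′
  k′ = k - 1ℤ
  b′ = b - 1ℤ
  c′ = c - 1ℤ
  separate : ∀ φ₀ x₀ y₀ z₀ g₁ g₂ g₃ g₄ f₁ f₂ f₃ f₄ →
    (φ₀ * g₁ + f₁) + (φ₀ * x₀ * g₂ + f₂) + (φ₀ * y₀ * g₃ + f₃) + (φ₀ * z₀ * g₄ + f₄)
    ≡ φ₀ * (g₁ + x₀ * g₂ + y₀ * g₃ + z₀ * g₄) + (f₁ + f₂ + f₃ + f₄)
  separate = solve-∀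

-- Outside the support of P: b < 0, c < 0 or k < b + c.
Outside : ℤ → ℤ → ℤ → Set
Outside k b c = b ℤ.< 0ℤ ⊎ c ℤ.< 0ℤ ⊎ k ℤ.< b + c

i-1<i : ∀ i → i - 1ℤ ℤ.< i
i-1<i i = subst (i - 1ℤ ℤ.<_) (+-identityʳ i) (+-monoʳ-< i (ℤ.-<+ {0} {0}))

pred< : ∀ {i j} → i ℤ.< j → i - 1ℤ ℤ.< j
pred< {i} = <-trans (i-1<i i)

pred<-shift : ∀ {k s t} → k ℤ.< s → s - 1ℤ ≡ t → k - 1ℤ ℤ.< t
pred<-shift {k} k<s s-1≡t = subst (k - 1ℤ ℤ.<_) s-1≡t (+-monoˡ-< -1ℤ k<s)

shift-b : ∀ b c → b + c - 1ℤ ≡ (b - 1ℤ) + c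
shift-b = solve-∀

shift-c : ∀ b c → b + c - 1ℤ ≡ b + (c - 1ℤ)
shift-c = solve-∀

outside-k : ∀ {k b c} → Outside k b c → Outside (k - 1ℤ) b c
outside-k = Sum.map₂ (Sum.map₂ pred<)

outside-b : ∀ {k b c} → Outside k b c → Outside (k - 1ℤ) (b - 1ℤ) c
outside-b {b = b} {c} = Sum.map pred< (Sum.map₂ (λ k<b+c → pred<-shift k<b+c (shift-b b c)))

outside-c : ∀ {k b c} → Outside k b c → Outside (k - 1ℤ) b (c - 1ℤ)
outside-c {b = b} {c} = Sum.map₂ (Sum.map pred< (λ k<b+c → pred<-shift k<b+c (shift-c b c)))

negative-outside : ∀ {k} b c → k ℤ.< 0ℤ → Outside k b c
negative-outside -[1+ m ] c     k<0 = inj₁ ℤ.-<+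
negative-outside (+ m)    -[1+ n ] k<0 = inj₂ (inj₁ ℤ.-<+)
negative-outside (+ m)    (+ n) k<0 = inj₂ (inj₂ (<-≤-trans k<0 (ℤ.+≤+ z≤n)))

one-outside : ∀ {k b c} → Outside k b c → one k b c ≡ 0ℤ
one-outside {k} { -[1+ m ]} {c}       _ = middle-zero (δ k) (δ c)
one-outside {k} {+ suc m}  {c}       _ = middle-zero (δ k) (δ c)
one-outside {k} {+ zero}   { -[1+ n ]} _ = *-zeroʳ (δ k * 1ℤ)
one-outside {k} {+ zero}   {+ suc n} _ = *-zeroʳ (δ k * 1ℤ)
one-outside { -[1+ n ]} {+ zero} {+ zero} _ = refl
one-outside {+ n} {+ zero} {+ zero} (inj₁ (ℤ.+<+ ()))
one-outside {+ n} {+ zero} {+ zero} (inj₂ (inj₁ (ℤ.+<+ ())))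
one-outside {+ n} {+ zero} {+ zero} (inj₂ (inj₂ (ℤ.+<+ ())))

prodCoeffs-outside : ∀ N x y z {k b c} → Outside k b c → prodCoeffs N x y z k b c ≡ 0ℤ
prodCoeffs-outside zero    x y z out = one-outside out
prodCoeffs-outside (suc N) x y z out =
  factor-zero (head x) (head y) (head z) {prodCoeffs N x′ y′ z′}
    (prodCoeffs-outside N x′ y′ z′ out) (prodCoeffs-outside N x′ y′ z′ (outside-k out))
    (prodCoeffs-outside N x′ y′ z′ (outside-b out)) (prodCoeffs-outside N x′ y′ z′ (outside-c out))
  where
  x′ = tail x
  y′ = tail y
  z′ = tail z

markedCoeffs-negative : ∀ N φ x y z {k} b c → k ℤ.< 0ℤ → markedCoeffs N φ x y z k b c ≡ 0ℤ
markedCoeffs-negative zero    φ x y z b c k<0 = refl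
markedCoeffs-negative (suc N) φ x y z {k} b c k<0 =
  trans (cong₂ (λ s t → head φ * s + t) G′-zero T′-zero) (zeros (head φ))
  where
  zeros : ∀ a → a * 0ℤ + 0ℤ ≡ 0ℤ
  zeros = solve-∀
  G′-zero : prodCoeffs N (tail x) (tail y) (tail z) k b c ≡ 0ℤ
  G′-zero = prodCoeffs-outside N (tail x) (tail y) (tail z) (negative-outside b c k<0)
  T′ = markedCoeffs N (tail φ) (tail x) (tail y) (tail z)
  T′-zero : factor (head x) (head y) (head z) T′ k b c ≡ 0ℤ
  T′-zero = factor-zero (head x) (head y) (head z) {T′}
    (markedCoeffs-negative N _ _ _ _ b c k<0) (markedCoeffs-negative N _ _ _ _ b c (pred< k<0))
    (markedCoeffs-negative N _ _ _ _ (b - 1ℤ) c (pred< k<0))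
    (markedCoeffs-negative N _ _ _ _ b (c - 1ℤ) (pred< k<0))

times-δ : ∀ b → b * δ b ≡ 0ℤ
times-δ (+ zero)  = refl
times-δ (+ suc n) = *-zeroʳ (+ suc n)
times-δ -[1+ n ]  = *-zeroʳ -[1+ n ]

-- Differentiation in u:  b·G(k,b,c) = T_y(k-1,b-1,c), each monomial y_B being counted once
-- for every marked j ∈ B.
u-derivative : ∀ N x y z k b c → b * prodCoeffs N x y z k b c ≡ markedCoeffs N y x y z (k - 1ℤ) (b - 1ℤ) c
u-derivative zero x y z k b c = begin
  b * (δ k * δ b * δ c)  ≡⟨ rearrange b (δ k) (δ b) (δ c) ⟩
  δ k * (b * δ b) * δ c  ≡⟨ cong (λ t → δ k * t * δ c) (times-δ b) ⟩
  δ k * 0ℤ * δ c         ≡⟨ middle-zero (δ k) (δ c) ⟩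
  0ℤ                     ∎
  where rearrange : ∀ b K B C → b * (K * B * C) ≡ K * (b * B) * C
        rearrange = solve-∀
u-derivative (suc N) x y z k b c = begin
  b * (g₁ + x₀ * g₂ + y₀ * g₃ + z₀ * g₄)
    ≡⟨ distribute b x₀ y₀ z₀ g₁ g₂ g₃ g₄ ⟩
  y₀ * g₃ + (b * g₁ + x₀ * (b * g₂) + y₀ * ((b - 1ℤ) * g₃) + z₀ * (b * g₄))
    ≡⟨ cong (λ t → y₀ * g₃ + t) (cong₄ (λ s t u v → s + x₀ * t + y₀ * u + z₀ * v)
         (IH k b c) (IH k′ b c) (IH k′ b′ c) (IH k′ b c′)) ⟩
  markedCoeffs (suc N) y x y z k′ b′ c ∎
  where
  x₀ = head x
  y₀ = head y
  z₀ = head z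
  G′ = prodCoeffs N (tail x) (tail y) (tail z)
  IH = u-derivative N (tail x) (tail y) (tail z)
  k′ = k - 1ℤ
  b′ = b - 1ℤ
  c′ = c - 1ℤ
  g₁ = G′ k b c
  g₂ = G′ k′ b c
  g₃ = G′ k′ b′ c
  g₄ = G′ k′ b c′
  distribute : ∀ b x₀ y₀ z₀ g₁ g₂ g₃ g₄ → b * (g₁ + x₀ * g₂ + y₀ * g₃ + z₀ * g₄)
    ≡ y₀ * g₃ + (b * g₁ + x₀ * (b * g₂) + y₀ * ((b - 1ℤ) * g₃) + z₀ * (b * g₄))
  distribute = solve-∀

v-derivative : ∀ N x y z k b c → c * prodCoeffs N x y z k b c ≡ markedCoeffs N z x y z (k - 1ℤ) b (c - 1ℤ)
v-derivative zero x y z k b c = begin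
  c * (δ k * δ b * δ c)  ≡⟨ rearrange c (δ k * δ b) (δ c) ⟩
  δ k * δ b * (c * δ c)  ≡⟨ cong (λ t → δ k * δ b * t) (times-δ c) ⟩
  δ k * δ b * 0ℤ         ≡⟨ *-zeroʳ (δ k * δ b) ⟩
  0ℤ                     ∎
  where rearrange : ∀ c KB C → c * (KB * C) ≡ KB * (c * C)
        rearrange = solve-∀
v-derivative (suc N) x y z k b c = begin
  c * (g₁ + x₀ * g₂ + y₀ * g₃ + z₀ * g₄)
    ≡⟨ distribute c x₀ y₀ z₀ g₁ g₂ g₃ g₄ ⟩
  z₀ * g₄ + (c * g₁ + x₀ * (c * g₂) + y₀ * (c * g₃) + z₀ * ((c - 1ℤ) * g₄))
    ≡⟨ cong (λ t → z₀ * g₄ + t) (cong₄ (λ s t u v → s + x₀ * t + y₀ * u + z₀ * v)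
         (IH k b c) (IH k′ b c) (IH k′ b′ c) (IH k′ b c′)) ⟩
  markedCoeffs (suc N) z x y z k′ b c′ ∎
  where
  x₀ = head x
  y₀ = head y
  z₀ = head z
  G′ = prodCoeffs N (tail x) (tail y) (tail z)
  IH = v-derivative N (tail x) (tail y) (tail z)
  k′ = k - 1ℤ
  b′ = b - 1ℤ
  c′ = c - 1ℤ
  g₁ = G′ k b c
  g₂ = G′ k′ b c
  g₃ = G′ k′ b′ c
  g₄ = G′ k′ b c′
  distribute : ∀ c x₀ y₀ z₀ g₁ g₂ g₃ g₄ → c * (g₁ + x₀ * g₂ + y₀ * g₃ + z₀ * g₄)
    ≡ z₀ * g₄ + (c * g₁ + x₀ * (c * g₂) + y₀ * (c * g₃) + z₀ * ((c - 1ℤ) * g₄))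
  distribute = solve-∀

-- markedCoeffs vanishes mod m when φ has vanishing weighted moments (φ is Good): by the
-- identity for markedCoeffs and induction on the t-degree, over all good weights at once.
module Vanishing {N : ℕ} (m : ℤ) (x y z : Vect N) where

  Good : Vect N → Set
  Good φ = ∀ i a b → m ∣ sum (λ j → φ j * monomial x y z i a b j)

  good-·x : ∀ {φ} → Good φ → Good (φ · x)
  good-·x {φ} good i a b =
    subst (m ∣_) (sum-cong-≗ λ j → absorb (φ j) (x j) (x j ^ i) (y j ^ a) (z j ^ b)) (good (suc i) a b)
    where absorb : ∀ f w X Y Z → f * (w * X * Y * Z) ≡ f * w * (X * Y * Z)
          absorb = solve-∀

  good-·y : ∀ {φ} → Good φ → Good (φ · y)
  good-·y {φ} good i a b =
    subst (m ∣_) (sum-cong-≗ λ j → absorb (φ j) (y j) (x j ^ i) (y j ^ a) (z j ^ b)) (good i (suc a) b)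
    where absorb : ∀ f w X Y Z → f * (X * (w * Y) * Z) ≡ f * w * (X * Y * Z)
          absorb = solve-∀

  good-·z : ∀ {φ} → Good φ → Good (φ · z)
  good-·z {φ} good i a b =
    subst (m ∣_) (sum-cong-≗ λ j → absorb (φ j) (z j) (x j ^ i) (y j ^ a) (z j ^ b)) (good i a (suc b))
    where absorb : ∀ f w X Y Z → f * (X * Y * (w * Z)) ≡ f * w * (X * Y * Z)
          absorb = solve-∀

  good-sum : ∀ {φ} → Good φ → m ∣ sum φ
  good-sum {φ} good = subst (m ∣_) (sum-cong-≗ λ j → *-identityʳ (φ j)) (good 0 0 0)

  -- If markedCoeffs of every good weight vanishes in degree k - 1, it vanishes in degree k:
  -- the identity expresses T_φ(k) through (Σ φ) P(k) and degree-(k-1) terms of good weights.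
  marked-step : ∀ {k} → (∀ {ψ} → Good ψ → ∀ b c → m ∣ markedCoeffs N ψ x y z (k - 1ℤ) b c) →
                ∀ {φ} → Good φ → ∀ b c → m ∣ markedCoeffs N φ x y z k b c
  marked-step {k} below {φ} good b c =
    ∣m+n∣n⇒∣m (∣m+n∣n⇒∣m (∣m+n∣n⇒∣m whole (below (good-·z {φ} good) b (c - 1ℤ)))
                                        (below (good-·y {φ} good) (b - 1ℤ) c))
                                        (below (good-·x {φ} good) b c)
    where
    T = λ ψ → markedCoeffs N ψ x y z
    whole : m ∣ combine (T φ) (T (φ · x)) (T (φ · y)) (T (φ · z)) k b c
    whole = subst (m ∣_) (sym (marked-identity N φ x y z k b c))
                  (∣m⇒∣m*n (prodCoeffs N x y z k b c) (good-sum good))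

  marked-vanish-+ : ∀ n {φ} → Good φ → ∀ b c → m ∣ markedCoeffs N φ x y z (+ n) b c
  marked-vanish-+ zero    = marked-step λ {ψ} _ b c →
    subst (m ∣_) (sym (markedCoeffs-negative N ψ x y z b c ℤ.-<+)) (divides 0ℤ refl)
  marked-vanish-+ (suc n) = marked-step (marked-vanish-+ n)

  marked-vanish : ∀ {φ} → Good φ → ∀ k b c → m ∣ markedCoeffs N φ x y z k b c
  marked-vanish good (+ n)     b c = marked-vanish-+ n good b c
  marked-vanish {φ} good -[1+ n ] b c =
    subst (m ∣_) (sym (markedCoeffs-negative N φ x y z b c ℤ.-<+)) (divides 0ℤ refl)

module _ {N : ℕ} (m : ℤ) (x y z : Vect N) where
  open Vanishing m x y z

  moments-good-y : (∀ i a b → m ∣ sum (monomial x y z i a b)) → Good y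
  moments-good-y moments i a b =
    subst (m ∣_) (sum-cong-≗ {N} λ j → absorb (y j) (x j ^ i) (y j ^ a) (z j ^ b)) (moments i (suc a) b)
    where absorb : ∀ w X Y Z → X * (w * Y) * Z ≡ w * (X * Y * Z)
          absorb = solve-∀

  moments-good-z : (∀ i a b → m ∣ sum (monomial x y z i a b)) → Good z
  moments-good-z moments i a b =
    subst (m ∣_) (sum-cong-≗ {N} λ j → absorb (z j) (x j ^ i) (y j ^ a) (z j ^ b)) (moments i a (suc b))
    where absorb : ∀ w X Y Z → X * Y * (w * Z) ≡ w * (X * Y * Z)
          absorb = solve-∀

sumMap : ∀ {A : Set} → (A → ℤ) → List A → ℤ
sumMap f xs = sumℤ (List.map f xs)

module _ {A : Set} where

  sumMap-cong : ∀ {f g : A → ℤ} → (∀ a → f a ≡ g a) → ∀ xs → sumMap f xs ≡ sumMap g xs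
  sumMap-cong f≗g xs = cong sumℤ (List.map-cong f≗g xs)

  sumMap-++ : ∀ (f : A → ℤ) xs ys → sumMap f (xs List.++ ys) ≡ sumMap f xs + sumMap f ys
  sumMap-++ f []       ys = sym (+-identityˡ _)
  sumMap-++ f (a ∷ xs) ys = trans (cong (λ t → f a + t) (sumMap-++ f xs ys)) (sym (+-assoc (f a) _ _))

  sumMap-+ : ∀ (f g : A → ℤ) xs → sumMap (λ a → f a + g a) xs ≡ sumMap f xs + sumMap g xs
  sumMap-+ f g []       = refl
  sumMap-+ f g (a ∷ xs) = trans (cong (λ t → f a + g a + t) (sumMap-+ f g xs)) (interchange (f a) (g a) _ _)
    where interchange : ∀ a b c d → a + b + (c + d) ≡ a + c + (b + d)
          interchange = solve-∀

  sumMap-scale : ∀ s (f : A → ℤ) xs → sumMap (λ a → s * f a) xs ≡ s * sumMap f xs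
  sumMap-scale s f []       = sym (*-zeroʳ s)
  sumMap-scale s f (a ∷ xs) =
    trans (cong (λ t → s * f a + t) (sumMap-scale s f xs)) (sym (*-distribˡ-+ s (f a) _))

  sumMap-zero : ∀ {f : A → ℤ} → (∀ a → f a ≡ 0ℤ) → ∀ xs → sumMap f xs ≡ 0ℤ
  sumMap-zero f≡0 []       = refl
  sumMap-zero f≡0 (a ∷ xs) = cong₂ _+_ (f≡0 a) (sumMap-zero f≡0 xs)

  sumMap-filter : ∀ {ℓ} {P : A → Set ℓ} (P? : Decidable P) (f : A → ℤ) xs →
    sumMap f (List.filter P? xs) ≡ sumMap (λ a → if does (P? a) then f a else 0ℤ) xs
  sumMap-filter P? f []       = refl
  sumMap-filter P? f (a ∷ xs) with does (P? a)
  ... | true  = cong (λ t → f a + t) (sumMap-filter P? f xs)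
  ... | false = trans (sumMap-filter P? f xs) (sym (+-identityˡ _))

sumMap-map : ∀ {A B : Set} (f : B → ℤ) (g : A → B) xs → sumMap f (List.map g xs) ≡ sumMap (f ∘ g) xs
sumMap-map f g xs = cong sumℤ (sym (List.map-∘ xs))

sumMap-cartesian : ∀ {A B : Set} (f : A × B → ℤ) xs ys →
  sumMap f (List.cartesianProduct xs ys) ≡ sumMap (λ a → sumMap (λ b → f (a , b)) ys) xs
sumMap-cartesian f []       ys = refl
sumMap-cartesian f (a ∷ xs) ys = begin
  sumMap f (List.map (a ,_) ys List.++ List.cartesianProduct xs ys)
    ≡⟨ sumMap-++ f (List.map (a ,_) ys) _ ⟩
  sumMap f (List.map (a ,_) ys) + sumMap f (List.cartesianProduct xs ys)
    ≡⟨ cong₂ _+_ (sumMap-map f (a ,_) ys) (sumMap-cartesian f xs ys) ⟩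
  sumMap (λ b → f (a , b)) ys + sumMap (λ a → sumMap (λ b → f (a , b)) ys) xs ∎

ΣS : (N : ℕ) → (Subset N → ℤ) → ℤ
ΣS N g = sumMap g (subsets N)

ΣS-suc : ∀ N g → ΣS (suc N) g ≡ ΣS N (g ∘ (outside ∷_)) + ΣS N (g ∘ (inside ∷_))
ΣS-suc N g = trans (sumMap-++ g (List.map (outside ∷_) (subsets N)) _)
                   (cong₂ _+_ (sumMap-map g _ (subsets N)) (sumMap-map g _ (subsets N)))

if-pull : ∀ t s {u v : ℤ} → u ≡ s * v → (if t then u else 0ℤ) ≡ s * (if t then v else 0ℤ)
if-pull true  s u≡sv = u≡sv
if-pull false s _    = sym (*-zeroʳ s)

elemSymℤ : ∀ {N} → Vect N → ℤ → ℤ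
elemSymℤ v (+ k)     = elemSym k v
elemSymℤ v -[1+ _ ]  = 0ℤ

sizeWeighted : ∀ {N} → ℕ → Vect N → Subset N → ℤ
sizeWeighted k v S = if ∣ S ∣ ℕ.≡ᵇ k then prodOver S v else 0ℤ

elemSym-as-ΣS : ∀ {N} k (v : Vect N) → elemSym k v ≡ ΣS N (sizeWeighted k v)
elemSym-as-ΣS {N} k v = sumMap-filter (λ S → ∣ S ∣ ℕ.≟ k) (λ S → prodOver S v) (subsets N)

elemSymℤ-suc : ∀ {N} (v : Vect (suc N)) k →
  elemSymℤ v k ≡ elemSymℤ (tail v) k + head v * elemSymℤ (tail v) (k - 1ℤ)
elemSymℤ-suc {N} v (+ k) = begin
  elemSym k v
    ≡⟨ elemSym-as-ΣS k v ⟩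
  ΣS (suc N) (sizeWeighted k v)
    ≡⟨ ΣS-suc N (sizeWeighted k v) ⟩
  ΣS N (sizeWeighted k (tail v)) + ΣS N (λ S → if suc ∣ S ∣ ℕ.≡ᵇ k then head v * prodOver S (tail v) else 0ℤ)
    ≡⟨ cong₂ _+_ (sym (elemSym-as-ΣS k (tail v))) (containing k) ⟩
  elemSym k (tail v) + head v * elemSymℤ (tail v) (+ k - 1ℤ) ∎
  where
  containing : ∀ k → ΣS N (λ S → if suc ∣ S ∣ ℕ.≡ᵇ k then head v * prodOver S (tail v) else 0ℤ)
                     ≡ head v * elemSymℤ (tail v) (+ k - 1ℤ)
  containing zero    = trans (sumMap-zero (λ _ → refl) (subsets N)) (sym (*-zeroʳ (head v)))
  containing (suc k) = begin
    ΣS N (λ S → if ∣ S ∣ ℕ.≡ᵇ k then head v * prodOver S (tail v) else 0ℤ)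
      ≡⟨ sumMap-cong (λ S → if-pull (∣ S ∣ ℕ.≡ᵇ k) (head v) refl) (subsets N) ⟩
    ΣS N (λ S → head v * sizeWeighted k (tail v) S)
      ≡⟨ sumMap-scale (head v) (sizeWeighted k (tail v)) (subsets N) ⟩
    head v * ΣS N (sizeWeighted k (tail v))
      ≡⟨ cong (head v *_) (elemSym-as-ΣS k (tail v)) ⟨
    head v * elemSym k (tail v) ∎
elemSymℤ-suc v -[1+ n ] = sym (zeros (head v))
  where zeros : ∀ a → 0ℤ + a * 0ℤ ≡ 0ℤ
        zeros = solve-∀

prodOver-cong : ∀ {N} (S : Subset N) {u v : Vect N} → (∀ j → u j ≡ v j) → prodOver S u ≡ prodOver S v
prodOver-cong Vec.[]        u≗v = refl
prodOver-cong (outside ∷ S) u≗v = prodOver-cong S (u≗v ∘ Fin.suc)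
prodOver-cong (inside ∷ S)  u≗v = cong₂ _*_ (u≗v Fin.zero) (prodOver-cong S (u≗v ∘ Fin.suc))

elemSym-cong : ∀ {N} k {u v : Vect N} → (∀ j → u j ≡ v j) → elemSym k u ≡ elemSym k v
elemSym-cong {N} k u≗v =
  sumMap-cong (λ S → prodOver-cong S u≗v) (List.filter (λ S → ∣ S ∣ ℕ.≟ k) (subsets N))

disjointWeight : ∀ {N} → ℕ → ℕ → Vect N → Vect N → Subset N → Subset N → ℤ
disjointWeight b c y z A B =
  if (∣ A ∣ ℕ.≡ᵇ b) ∧ ((∣ B ∣ ℕ.≡ᵇ c) ∧ (∣ A ∩ B ∣ ℕ.≡ᵇ 0))
  then prodOver A y * prodOver B z else 0ℤ

Hℤ : ∀ {N} → Vect N → Vect N → ℤ → ℤ → ℤ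
Hℤ {N} y z (+ b) (+ c) = ΣS N (λ A → ΣS N (disjointWeight b c y z A))
Hℤ     y z _     _     = 0ℤ

H-as-Hℤ : ∀ {N} p (y z : Vect N) → H p y z ≡ Hℤ y z (+ p) (+ p)
H-as-Hℤ {N} p y z =
  trans (sumMap-filter _ _ (List.cartesianProduct (subsets N) (subsets N)))
        (sumMap-cartesian _ (subsets N) (subsets N))

-- The recursion  H_{b,c}(y,z) = H_{b,c}(y′,z′) + z₀ H_{b,c-1}(y′,z′) + y₀ H_{b-1,c}(y′,z′),
-- by the position of the first point (in neither set, in B only, in A only; not in both).
module _ {N : ℕ} (y z : Vect (suc N)) where
  private
    y′ = tail y
    z′ = tail z
    ΣΣ : (Subset N → Subset N → ℤ) → ℤ
    ΣΣ w = ΣS N (λ A → ΣS N (w A))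

    pull-out : ∀ s {w w′ : Subset N → Subset N → ℤ} →
               (∀ A B → w A B ≡ s * w′ A B) → ΣΣ w ≡ s * ΣΣ w′
    pull-out s w≡sw′ = trans (sumMap-cong inner (subsets N)) (sumMap-scale s _ (subsets N))
      where inner = λ A → trans (sumMap-cong (w≡sw′ A) (subsets N)) (sumMap-scale s _ (subsets N))

    vanish : ∀ {w : Subset N → Subset N → ℤ} → (∀ A B → w A B ≡ 0ℤ) → ΣΣ w ≡ 0ℤ
    vanish w≡0 = sumMap-zero (λ A → sumMap-zero (w≡0 A) (subsets N)) (subsets N)

    zeros : ∀ s t → 0ℤ + s * 0ℤ + t * 0ℤ ≡ 0ℤ
    zeros = solve-∀

    if-false : ∀ {t} (u : ℤ) → t ≡ false → (if t then u else 0ℤ) ≡ 0ℤ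
    if-false u refl = refl

  only-in-B : ∀ b c → ΣΣ (λ A B → disjointWeight b c y z (outside ∷ A) (inside ∷ B))
                      ≡ head z * Hℤ y′ z′ (+ b) (+ c - 1ℤ)
  only-in-B b zero    =
    trans (vanish λ A B → if-false _ (∧-zeroʳ (∣ A ∣ ℕ.≡ᵇ b))) (sym (*-zeroʳ (head z)))
  only-in-B b (suc c) =
    pull-out (head z) λ A B → if-pull _ (head z) (swap (prodOver A y′) (head z) (prodOver B z′))
    where swap : ∀ P s Q → P * (s * Q) ≡ s * (P * Q)
          swap = solve-∀

  only-in-A : ∀ b c → ΣΣ (λ A B → disjointWeight b c y z (inside ∷ A) (outside ∷ B))
                      ≡ head y * Hℤ y′ z′ (+ b - 1ℤ) (+ c)
  only-in-A zero    c = trans (vanish λ A B → refl) (sym (*-zeroʳ (head y)))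
  only-in-A (suc b) c =
    pull-out (head y) λ A B → if-pull _ (head y) (*-assoc (head y) (prodOver A y′) (prodOver B z′))

  in-both : ∀ b c → ΣΣ (λ A B → disjointWeight b c y z (inside ∷ A) (inside ∷ B)) ≡ 0ℤ
  in-both b c =
    vanish λ A B → if-false _ (trans (cong ((suc ∣ A ∣ ℕ.≡ᵇ b) ∧_) (∧-zeroʳ _)) (∧-zeroʳ _))

  Hℤ-suc : ∀ b c →
    Hℤ y z b c ≡ Hℤ y′ z′ b c + head z * Hℤ y′ z′ b (c - 1ℤ) + head y * Hℤ y′ z′ (b - 1ℤ) c
  Hℤ-suc -[1+ m ]  c        = sym (zeros (head z) (head y))
  Hℤ-suc (+ zero)  -[1+ n ] = sym (zeros (head z) (head y))
  Hℤ-suc (+ suc b) -[1+ n ] = sym (zeros (head z) (head y))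
  Hℤ-suc (+ b)     (+ c)    = begin
    ΣS (suc N) (λ A → ΣS (suc N) (w A))
      ≡⟨ ΣS-suc N _ ⟩
    ΣS N (λ A → ΣS (suc N) (w (outside ∷ A))) + ΣS N (λ A → ΣS (suc N) (w (inside ∷ A)))
      ≡⟨ cong₂ _+_ (split outside) (split inside) ⟩
    (H₀ + ΣΣ (λ A B → w (outside ∷ A) (inside ∷ B)))
      + (ΣΣ (λ A B → w (inside ∷ A) (outside ∷ B)) + ΣΣ (λ A B → w (inside ∷ A) (inside ∷ B)))
      ≡⟨ cong₂ (λ s t → (H₀ + s) + t) (only-in-B b c) (cong₂ _+_ (only-in-A b c) (in-both b c)) ⟩
    (H₀ + head z * H₋c) + (head y * H₋b + 0ℤ)
      ≡⟨ drop-zero H₀ (head z * H₋c) (head y * H₋b) ⟩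
    H₀ + head z * H₋c + head y * H₋b ∎
    where
    w = disjointWeight b c y z
    H₀ = Hℤ y′ z′ (+ b) (+ c)
    H₋c = Hℤ y′ z′ (+ b) (+ c - 1ℤ)
    H₋b = Hℤ y′ z′ (+ b - 1ℤ) (+ c)
    split : ∀ s → ΣS N (λ A → ΣS (suc N) (w (s ∷ A)))
                  ≡ ΣΣ (λ A B → w (s ∷ A) (outside ∷ B)) + ΣΣ (λ A B → w (s ∷ A) (inside ∷ B))
    split s = trans (sumMap-cong (λ A → ΣS-suc N (w (s ∷ A))) (subsets N)) (sumMap-+ _ _ (subsets N))
    drop-zero : ∀ a b c → (a + b) + (c + 0ℤ) ≡ a + b + c
    drop-zero = solve-∀

diagonal : ∀ N x y z b c → prodCoeffs N x y z (b + c) b c ≡ Hℤ y z b c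
diagonal zero x y z -[1+ m ]  c         = middle-zero (δ (-[1+ m ] + c)) (δ c)
diagonal zero x y z (+ b)     -[1+ n ]  = *-zeroʳ (δ (+ b + -[1+ n ]) * δ (+ b))
diagonal zero x y z (+ zero)  (+ zero)  = refl
diagonal zero x y z (+ zero)  (+ suc n) = refl
diagonal zero x y z (+ suc m) (+ n)     = refl
diagonal (suc N) x y z b c = begin
  G′ (b + c) b c + x₀ * G′ (b + c - 1ℤ) b c + y₀ * G′ (b + c - 1ℤ) b′ c + z₀ * G′ (b + c - 1ℤ) b c′
    ≡⟨ cong₄ (λ s t u v → s + x₀ * t + y₀ * u + z₀ * v)
         (diagonal N x′ y′ z′ b c)
         (prodCoeffs-outside N x′ y′ z′ (inj₂ (inj₂ (i-1<i (b + c)))))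
         (trans (cong (λ k → G′ k b′ c) (shift-b b c)) (diagonal N x′ y′ z′ b′ c))
         (trans (cong (λ k → G′ k b c′) (shift-c b c)) (diagonal N x′ y′ z′ b c′)) ⟩
  Hℤ y′ z′ b c + x₀ * 0ℤ + y₀ * Hℤ y′ z′ b′ c + z₀ * Hℤ y′ z′ b c′
    ≡⟨ reorder (Hℤ y′ z′ b c) x₀ y₀ z₀ (Hℤ y′ z′ b′ c) (Hℤ y′ z′ b c′) ⟩
  Hℤ y′ z′ b c + z₀ * Hℤ y′ z′ b c′ + y₀ * Hℤ y′ z′ b′ c
    ≡⟨ Hℤ-suc y z b c ⟨
  Hℤ y z b c ∎
  where
  x₀ = head x
  y₀ = head y
  z₀ = head z
  x′ = tail x
  y′ = tail y
  z′ = tail z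
  G′ = prodCoeffs N x′ y′ z′
  b′ = b - 1ℤ
  c′ = c - 1ℤ
  reorder : ∀ h x₀ y₀ z₀ h₁ h₂ → h + x₀ * 0ℤ + y₀ * h₁ + z₀ * h₂ ≡ h + z₀ * h₂ + y₀ * h₁
  reorder = solve-∀

wsum : ℤ → ℕ → (ℤ → ℤ) → ℤ
wsum β K f = sum {suc K} (λ i → β ^ toℕ i * f (+ toℕ i))

module _ (β : ℤ) (K : ℕ) where

  wsum-cong : ∀ {f g} → (∀ i → f (+ i) ≡ g (+ i)) → wsum β K f ≡ wsum β K g
  wsum-cong f≗g = sum-cong-≗ {suc K} λ i → cong (β ^ toℕ i *_) (f≗g (toℕ i))

  wsum-+ : ∀ f g → wsum β K (λ i → f i + g i) ≡ wsum β K f + wsum β K g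
  wsum-+ f g = trans (sum-cong-≗ {suc K} λ i → *-distribˡ-+ (β ^ toℕ i) (f (+ toℕ i)) (g (+ toℕ i)))
                   (∑-distrib-+ {suc K} (λ i → β ^ toℕ i * f (+ toℕ i)) (λ i → β ^ toℕ i * g (+ toℕ i)))

  wsum-scale : ∀ s f → wsum β K (λ i → s * f i) ≡ s * wsum β K f
  wsum-scale s f = trans (sum-cong-≗ {suc K} λ i → swap (β ^ toℕ i) s (f (+ toℕ i)))
                       (sym (*-distribˡ-sum {suc K} s (λ i → β ^ toℕ i * f (+ toℕ i))))
    where swap : ∀ w s a → w * (s * a) ≡ s * (w * a)
          swap = solve-∀

  wsum-zero : ∀ {f} → (∀ i → f (+ i) ≡ 0ℤ) → wsum β K f ≡ 0ℤ
  wsum-zero f≡0 =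
    trans (sum-cong-≗ {suc K} λ i → trans (cong (β ^ toℕ i *_) (f≡0 (toℕ i))) (*-zeroʳ (β ^ toℕ i)))
          (sum-replicate-zero (suc K))

  wsum-combination : ∀ f₁ f₂ f₃ f₄ s₂ s₃ s₄ →
    wsum β K (λ i → f₁ i + s₂ * f₂ i + s₃ * f₃ i + s₄ * f₄ i)
    ≡ wsum β K f₁ + s₂ * wsum β K f₂ + s₃ * wsum β K f₃ + s₄ * wsum β K f₄
  wsum-combination f₁ f₂ f₃ f₄ s₂ s₃ s₄ = begin
    wsum β K (λ i → f₁ i + s₂ * f₂ i + s₃ * f₃ i + s₄ * f₄ i)
      ≡⟨ wsum-+ (λ i → f₁ i + s₂ * f₂ i + s₃ * f₃ i) (λ i → s₄ * f₄ i) ⟩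
    wsum β K (λ i → f₁ i + s₂ * f₂ i + s₃ * f₃ i) + wsum β K (λ i → s₄ * f₄ i)
      ≡⟨ cong₂ _+_ (wsum-+ (λ i → f₁ i + s₂ * f₂ i) (λ i → s₃ * f₃ i)) (wsum-scale s₄ f₄) ⟩
    wsum β K (λ i → f₁ i + s₂ * f₂ i) + wsum β K (λ i → s₃ * f₃ i) + s₄ * wsum β K f₄
      ≡⟨ cong₂ (λ s t → s + t + s₄ * wsum β K f₄) (wsum-+ f₁ (λ i → s₂ * f₂ i)) (wsum-scale s₃ f₃) ⟩
    wsum β K f₁ + wsum β K (λ i → s₂ * f₂ i) + s₃ * wsum β K f₃ + s₄ * wsum β K f₄
      ≡⟨ cong (λ t → wsum β K f₁ + t + s₃ * wsum β K f₃ + s₄ * wsum β K f₄) (wsum-scale s₂ f₂) ⟩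
    wsum β K f₁ + s₂ * wsum β K f₂ + s₃ * wsum β K f₃ + s₄ * wsum β K f₄ ∎

  wsum-shift : ∀ f → f -1ℤ ≡ 0ℤ → f (+ K) ≡ 0ℤ → wsum β K (λ i → f (i - 1ℤ)) ≡ β * wsum β K f
  wsum-shift f f[-1]≡0 f[K]≡0 = begin
    1ℤ * f -1ℤ + sum {K} (λ i → β ^ suc (toℕ i) * f (+ toℕ i))
      ≡⟨ cong₂ _+_ (cong (1ℤ *_) f[-1]≡0) (sum-cong-≗ {K} λ i → *-assoc β (β ^ toℕ i) (f (+ toℕ i))) ⟩
    0ℤ + sum {K} (λ i → β * term i)
      ≡⟨ +-identityˡ _ ⟩
    sum {K} (λ i → β * term i)
      ≡⟨ *-distribˡ-sum {K} β term ⟨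
    β * sum term
      ≡⟨ cong (β *_) drop-last ⟨
    β * wsum β K f ∎
    where
    term : Fin K → ℤ
    term i = β ^ toℕ i * f (+ toℕ i)
    last≡0 : β ^ toℕ (fromℕ K) * f (+ toℕ (fromℕ K)) ≡ 0ℤ
    last≡0 = trans (cong (λ j → β ^ j * f (+ j)) (toℕ-fromℕ K))
                   (trans (cong (β ^ K *_) f[K]≡0) (*-zeroʳ (β ^ K)))
    drop-last : wsum β K f ≡ sum term
    drop-last = begin
      wsum β K f
        ≡⟨ sum-init-last {K} (λ i → β ^ toℕ i * f (+ toℕ i)) ⟩
      sum {K} (λ i → β ^ toℕ (inject₁ i) * f (+ toℕ (inject₁ i)))
        + β ^ toℕ (fromℕ K) * f (+ toℕ (fromℕ K))
        ≡⟨ cong₂ _+_ (sum-cong-≗ {K} λ i → cong (λ j → β ^ j * f (+ j)) (toℕ-inject₁ i)) last≡0 ⟩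
      sum term + 0ℤ
        ≡⟨ +-identityʳ _ ⟩
      sum term ∎

  wsum-δ : ∀ a → wsum β K (λ i → a * δ i) ≡ a
  wsum-δ a = begin
    1ℤ * (a * 1ℤ) + sum {K} (λ i → β ^ suc (toℕ i) * (a * 0ℤ))
      ≡⟨ cong (λ t → 1ℤ * (a * 1ℤ) + t)
              (trans (sum-cong-≗ {K} λ i → annihilate (β ^ suc (toℕ i)) a) (sum-replicate-zero K)) ⟩
    1ℤ * (a * 1ℤ) + 0ℤ
      ≡⟨ units a ⟩
    a ∎
    where
    annihilate : ∀ w a → w * (a * 0ℤ) ≡ 0ℤ
    annihilate = solve-∀
    units : ∀ a → 1ℤ * (a * 1ℤ) + 0ℤ ≡ a
    units = solve-∀

wsum-difference : ∀ K f → wsum 1ℤ K f - wsum 0ℤ K f ≡ sum {K} (λ i → f (+ suc (toℕ i)))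
wsum-difference K f = begin
  (1ℤ * f (+ 0) + sum {K} (λ i → 1ℤ ^ suc (toℕ i) * f (+ suc (toℕ i))))
    - (1ℤ * f (+ 0) + sum {K} (λ i → 0ℤ ^ suc (toℕ i) * f (+ suc (toℕ i))))
    ≡⟨ cong₂ (λ s t → (1ℤ * f (+ 0) + s) - (1ℤ * f (+ 0) + t))
         (sum-cong-≗ {K} λ i → trans (cong (_* f (+ suc (toℕ i))) (^-zeroˡ (suc (toℕ i)))) (*-identityˡ _))
         (sum-replicate-zero K) ⟩
  (1ℤ * f (+ 0) + sum {K} (λ i → f (+ suc (toℕ i)))) - (1ℤ * f (+ 0) + 0ℤ)
    ≡⟨ cancel (1ℤ * f (+ 0)) _ ⟩
  sum {K} (λ i → f (+ suc (toℕ i))) ∎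
  where cancel : ∀ a s → (a + s) - (a + 0ℤ) ≡ s
        cancel = solve-∀

eval : ℤ → ℤ → ℕ → Coeffs → ℤ → ℤ
eval β γ K X k = wsum β K (λ b → wsum γ K (λ c → X k b c))

eval-one : ∀ β γ K k → eval β γ K one k ≡ δ k
eval-one β γ K k =
  trans (wsum-cong β K {λ b → wsum γ K (λ c → one k b c)} {λ b → δ k * δ b} λ b → wsum-δ γ K (δ k * δ (+ b)))
        (wsum-δ β K (δ k))

below-box : ∀ {k K n} → k ℤ.≤ + K → K ℕ.≤ n → k - 1ℤ ℤ.< + n
below-box {k} k≤K K≤n = <-≤-trans (i-1<i k) (≤-trans k≤K (ℤ.+≤+ K≤n))

eval-prodCoeffs-suc : ∀ N x y z β γ K {k} → k ℤ.≤ + K →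
  eval β γ K (prodCoeffs (suc N) x y z) k
  ≡ eval β γ K (prodCoeffs N (tail x) (tail y) (tail z)) k
    + (head x + β * head y + γ * head z) * eval β γ K (prodCoeffs N (tail x) (tail y) (tail z)) (k - 1ℤ)
eval-prodCoeffs-suc N x y z β γ K {k} k≤K = begin
  wsum β K F-row
    ≡⟨ wsum-cong β K {F-row} {regrouped} inner ⟩
  wsum β K (λ b → slice b + x₀ * row b + y₀ * row (b - 1ℤ) + z₀ * (γ * row b))
    ≡⟨ wsum-combination β K slice row (λ b → row (b - 1ℤ)) (λ b → γ * row b) x₀ y₀ z₀ ⟩
  E + x₀ * E′ + y₀ * wsum β K (λ b → row (b - 1ℤ)) + z₀ * wsum β K (λ b → γ * row b)
    ≡⟨ cong₂ (λ s t → E + x₀ * E′ + y₀ * s + z₀ * t)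
             (wsum-shift β K row row[-1]≡0 row[K]≡0) (wsum-scale β K γ row) ⟩
  E + x₀ * E′ + y₀ * (β * E′) + z₀ * (γ * E′)
    ≡⟨ collect E E′ x₀ y₀ z₀ β γ ⟩
  E + (x₀ + β * y₀ + γ * z₀) * E′ ∎
  where
  x₀ = head x
  y₀ = head y
  z₀ = head z
  x′ = tail x
  y′ = tail y
  z′ = tail z
  G′ = prodCoeffs N x′ y′ z′
  k′ = k - 1ℤ
  slice : ℤ → ℤ
  slice b = wsum γ K (λ c → G′ k b c)
  row : ℤ → ℤ
  row b = wsum γ K (λ c → G′ k′ b c)
  F-row : ℤ → ℤ
  F-row b = wsum γ K (λ c → factor x₀ y₀ z₀ G′ k b c)
  regrouped : ℤ → ℤ
  regrouped b = slice b + x₀ * row b + y₀ * row (b - 1ℤ) + z₀ * (γ * row b)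
  E = eval β γ K G′ k
  E′ = eval β γ K G′ k′
  inner : ∀ i → F-row (+ i) ≡ regrouped (+ i)
  inner i = trans
    (wsum-combination γ K (G′ k (+ i)) (G′ k′ (+ i)) (G′ k′ (+ i - 1ℤ)) (λ c → G′ k′ (+ i) (c - 1ℤ)) x₀ y₀ z₀)
    (cong (λ t → slice (+ i) + x₀ * row (+ i) + y₀ * row (+ i - 1ℤ) + z₀ * t)
          (wsum-shift γ K (G′ k′ (+ i))
            (prodCoeffs-outside N x′ y′ z′ (inj₂ (inj₁ ℤ.-<+)))
            (prodCoeffs-outside N x′ y′ z′ (inj₂ (inj₂ (below-box k≤K (ℕ.m≤n+m K i)))))))
  row[-1]≡0 : row -1ℤ ≡ 0ℤ
  row[-1]≡0 = wsum-zero γ K {G′ k′ -1ℤ} λ j → prodCoeffs-outside N x′ y′ z′ (inj₁ ℤ.-<+)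
  row[K]≡0 : row (+ K) ≡ 0ℤ
  row[K]≡0 = wsum-zero γ K {G′ k′ (+ K)} λ j →
    prodCoeffs-outside N x′ y′ z′ (inj₂ (inj₂ (below-box k≤K (ℕ.m≤m+n K j))))
  collect : ∀ E E′ x₀ y₀ z₀ β γ →
    E + x₀ * E′ + y₀ * (β * E′) + z₀ * (γ * E′) ≡ E + (x₀ + β * y₀ + γ * z₀) * E′
  collect = solve-∀

elemSymℤ-empty : ∀ (v : Vect 0) k → elemSymℤ v k ≡ δ k
elemSymℤ-empty v (+ zero)  = refl
elemSymℤ-empty v (+ suc k) = refl
elemSymℤ-empty v -[1+ k ]  = refl

expansion : ∀ N x y z β γ K {k} → k ℤ.≤ + K →
  elemSymℤ (λ j → x j + β * y j + γ * z j) k ≡ eval β γ K (prodCoeffs N x y z) k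
expansion zero    x y z β γ K {k} _   = trans (elemSymℤ-empty _ k) (sym (eval-one β γ K k))
expansion (suc N) x y z β γ K {k} k≤K = begin
  elemSymℤ v k
    ≡⟨ elemSymℤ-suc v k ⟩
  elemSymℤ (tail v) k + head v * elemSymℤ (tail v) (k - 1ℤ)
    ≡⟨ cong₂ (λ s t → s + head v * t) (expansion N x′ y′ z′ β γ K k≤K)
                                      (expansion N x′ y′ z′ β γ K (<⇒≤ (<-≤-trans (i-1<i k) k≤K))) ⟩
  eval β γ K G′ k + head v * eval β γ K G′ (k - 1ℤ)
    ≡⟨ eval-prodCoeffs-suc N x y z β γ K k≤K ⟨
  eval β γ K (prodCoeffs (suc N) x y z) k ∎
  where
  v = λ j → x j + β * y j + γ * z j
  x′ = tail x
  y′ = tail y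
  z′ = tail z
  G′ = prodCoeffs N x′ y′ z′

second-difference : ∀ N x y z {k K} → k ℕ.≤ K →
  Δ² y z (elemSym k) x
  ≡ sum {K} (λ b → sum {K} (λ c → prodCoeffs N x y z (+ k) (+ suc (toℕ b)) (+ suc (toℕ c))))
second-difference N x y z {k} {K} k≤K = begin
  (elemSym k ((x ⊕ z) ⊕ y) - elemSym k (x ⊕ z)) - (elemSym k (x ⊕ y) - elemSym k x)
    ≡⟨ cong₂ _-_ (cong₂ _-_ (at 1ℤ 1ℤ λ j → r₁₁ (x j) (y j) (z j))
                            (at 0ℤ 1ℤ λ j → r₀₁ (x j) (y j) (z j)))
                 (cong₂ _-_ (at 1ℤ 0ℤ λ j → r₁₀ (x j) (y j) (z j))
                            (at 0ℤ 0ℤ λ j → r₀₀ (x j) (y j) (z j))) ⟩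
  (wsum 1ℤ K (row 1ℤ) - wsum 0ℤ K (row 1ℤ)) - (wsum 1ℤ K (row 0ℤ) - wsum 0ℤ K (row 0ℤ))
    ≡⟨ cong₂ _-_ (wsum-difference K (row 1ℤ)) (wsum-difference K (row 0ℤ)) ⟩
  sum {K} (λ b → row 1ℤ (+ suc (toℕ b))) - sum {K} (λ b → row 0ℤ (+ suc (toℕ b)))
    ≡⟨ sum-sub {K} (λ b → row 1ℤ (+ suc (toℕ b))) (λ b → row 0ℤ (+ suc (toℕ b))) ⟩
  sum {K} (λ b → row 1ℤ (+ suc (toℕ b)) - row 0ℤ (+ suc (toℕ b)))
    ≡⟨ sum-cong-≗ {K} (λ b → wsum-difference K (prodCoeffs N x y z (+ k) (+ suc (toℕ b)))) ⟩
  sum {K} (λ b → sum {K} (λ c → prodCoeffs N x y z (+ k) (+ suc (toℕ b)) (+ suc (toℕ c)))) ∎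
  where
  row : ℤ → ℤ → ℤ
  row γ b = wsum γ K (λ c → prodCoeffs N x y z (+ k) b c)
  at : ∀ β γ {u} → (∀ j → u j ≡ x j + β * y j + γ * z j) →
       elemSym k u ≡ eval β γ K (prodCoeffs N x y z) (+ k)
  at β γ u≗ = trans (elemSym-cong k u≗) (expansion N x y z β γ K (ℤ.+≤+ k≤K))
  r₁₁ : ∀ a b c → (a + c) + b ≡ a + 1ℤ * b + 1ℤ * c
  r₁₁ = solve-∀
  r₀₁ : ∀ a b c → a + c ≡ a + 0ℤ * b + 1ℤ * c
  r₀₁ = solve-∀
  r₁₀ : ∀ a b c → a + b ≡ a + 1ℤ * b + 0ℤ * c
  r₁₀ = solve-∀
  r₀₀ : ∀ a b c → a ≡ a + 0ℤ * b + 0ℤ * c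
  r₀₀ = solve-∀

H-as-diagonal : ∀ N p x y z → H p y z ≡ prodCoeffs N x y z (+ (2 ℕ.* p)) (+ p) (+ p)
H-as-diagonal N p x y z = begin
  H p y z                                       ≡⟨ H-as-Hℤ p y z ⟩
  Hℤ y z (+ p) (+ p)                            ≡⟨ diagonal N x y z (+ p) (+ p) ⟨
  prodCoeffs N x y z (+ (p ℕ.+ p)) (+ p) (+ p)  ≡⟨ cong (λ k → prodCoeffs N x y z (+ (p ℕ.+ k)) (+ p) (+ p))
                                                        (sym (ℕ.+-identityʳ p)) ⟩
  prodCoeffs N x y z (+ (2 ℕ.* p)) (+ p) (+ p)  ∎

off-diagonal : ∀ {p N} → Prime p → (x y z : Vect N) → (∀ i a b → + p ∣ sum (monomial x y z i a b)) →
  ∀ b c → suc b ≢ p ⊎ suc c ≢ p → + p ∣ prodCoeffs N x y z (+ (2 ℕ.* p)) (+ suc b) (+ suc c)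
off-diagonal {p} {N} pr x y z moments b c off with p ℕ.∣? suc b | p ℕ.∣? suc c
... | no p∤b | _ =
  prime-cancel pr p∤b (subst (+ p ∣_) (sym (u-derivative N x y z (+ (2 ℕ.* p)) (+ suc b) (+ suc c)))
                             (marked-vanish (moments-good-y (+ p) x y z moments) _ _ _))
  where open Vanishing (+ p) x y z
... | yes _ | no p∤c =
  prime-cancel pr p∤c (subst (+ p ∣_) (sym (v-derivative N x y z (+ (2 ℕ.* p)) (+ suc b) (+ suc c)))
                             (marked-vanish (moments-good-z (+ p) x y z moments) _ _ _))
  where open Vanishing (+ p) x y z
... | yes p∣b | yes p∣c =
  subst (+ p ∣_) (sym (prodCoeffs-outside N x y z (inj₂ (inj₂ (ℤ.+<+ (beyond off)))))) (divides 0ℤ refl)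
  where
  beyond : suc b ≢ p ⊎ suc c ≢ p → 2 ℕ.* p ℕ.< suc b ℕ.+ suc c
  beyond (inj₁ b≢p) =
    subst (ℕ._< suc b ℕ.+ suc c) (ℕ.+-identityʳ _) (ℕ.+-mono-≤-< (multiple≥2p p∣b (s≤s z≤n) b≢p) (s≤s z≤n))
  beyond (inj₂ c≢p) = ℕ.+-mono-<-≤ (s≤s z≤n) (multiple≥2p p∣c (s≤s z≤n) c≢p)

-- The theorem: the second difference of S_{2p} is the double sum of the coefficients with
-- b, c ≥ 1 (indexed by Fin (2p) through b = i + 1); all of them but the one at i₀ = p - 1 vanish
-- mod p, and that one is H.
lemma3p1 : (p N : ℕ) → Prime p → (x y z : Vect N) →
    (∀ a b i → a ℕ.< p → b ℕ.< p → i ℕ.< p →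
      (+ p) Unsigned.∣ Σ[j] N (λ j → ((x j ^ i) * (y j ^ a)) * (z j ^ b))) →
    (+ p) Unsigned.∣ (Δ² y z (elemSym (2 ℕ.* p)) x - H p y z)
lemma3p1 zero       N pr = contradiction pr ¬prime[0]
lemma3p1 p@(suc p′) N pr x y z small = ∣⇒∣ᵤ (subst (+ p ∣_) (sym reduction) (∣-sum²-isolate i₀ i₀ off))
  where
  moments : ∀ i a b → + p ∣ sum (monomial x y z i a b)
  moments = all-moments pr x y z λ i a b i<p a<p b<p →
    subst (+ p ∣_) (Σ[j]≡sum N _) (∣ᵤ⇒∣ (small a b i a<p b<p i<p))

  i₀ : Fin (2 ℕ.* p)
  i₀ = Fin.fromℕ< (ℕ.m≤m+n p (p ℕ.+ 0))

  term′ : ℕ → ℕ → ℤ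
  term′ b c = prodCoeffs N x y z (+ (2 ℕ.* p)) (+ b) (+ c)

  term : Fin (2 ℕ.* p) → Fin (2 ℕ.* p) → ℤ
  term b c = term′ (suc (toℕ b)) (suc (toℕ c))

  index≢ : ∀ b → b ≢ i₀ → suc (toℕ b) ≢ p
  index≢ b b≢i₀ eq = b≢i₀ (toℕ-injective (trans (ℕ.suc-injective eq) (sym (toℕ-fromℕ< _))))

  off : ∀ b c → b ≢ i₀ ⊎ c ≢ i₀ → + p ∣ term b c
  off b c = off-diagonal pr x y z moments (toℕ b) (toℕ c) ∘ Sum.map (index≢ b) (index≢ c)

  reduction : Δ² y z (elemSym (2 ℕ.* p)) x - H p y z ≡ sum (λ b → sum (term b)) - term i₀ i₀
  reduction = cong₂ _-_ (second-difference N x y z ℕ.≤-refl)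
    (trans (H-as-diagonal N p x y z) (cong (λ b → term′ b b) (cong suc (sym (toℕ-fromℕ< _)))))
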